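{- Let $(a,b,c,d)\in\mathbb{R}_{\ge0}^4$. Then $(a,b,c,d)\in\overline{\mathcal{F}_>}$ if and only if there exist nonnegative reals $w(\langle1\rangle_+),w(\langle1\rangle_-),w(\langle2\rangle_+),w(\langle2\rangle_-),w(\langle3\rangle_+),w(\langle3\rangle_-)$ satisfying $a=w(\langle1\rangle_-)+w(\langle2\rangle_+)+w(\langle3\rangle_+)$, $b=w(\langle1\rangle_+)+w(\langle2\rangle_-)+w(\langle3\rangle_+)$, $c=w(\langle1\rangle_+)+w(\langle2\rangle_+)+w(\langle3\rangle_-)$, $d=w(\langle1\rangle_-)+w(\langle2\rangle_-)+w(\langle3\rangle_-)$.
   Context: $\overline{\mathcal{F}_>}$ denotes the set of $(a,b,c,d)\in\mathbb{R}_{\ge0}^4$ satisfying $a\le b+c+d$, $b\le a+c+d$, $c\le a+b+d$ and $d\le a+b+c$. The six symbols $\langle i\rangle_\pm$ ($i=1,2,3$) denote signed pairings (pairing $i$ with sign $\pm$); here $w$ is simply an assignment of a real number to each of these six symbols (a "weight function"). -}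

module Defs where

open import Level using (Level; suc; _⊔_)
open import Data.Product using (_×_; Σ; ∃)
open import Relation.Binary.PropositionalEquality using (_≡_)
open import Relation.Binary.Structures using (IsTotalOrder)
open import Relation.Nullary using (¬_)
open import Algebra.Structures using (IsCommutativeRing)

-- An ordered field (axiomatised).  The real numbers ℝ are an instance;
-- the theorem is stated for every ordered field, hence in particular for ℝ.
record OrderedField (c ℓ : Level) : Set (suc (c ⊔ ℓ)) where
  infixl 6 _+_
  infixl 7 _*_
  infix  4 _≤_
  field
    Carrier : Set c
    _+_ _*_ : Carrier → Carrier → Carrier
    -_      : Carrier → Carrier
    0# 1#   : Carrier
    _≤_     : Carrier → Carrier → Set ℓ
    isCommutativeRing : IsCommutativeRing _≡_ _+_ _*_ -_ 0# 1#
    0≢1     : ¬ (0# ≡ 1#)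
    inverse : ∀ x → ¬ (x ≡ 0#) → Σ Carrier (λ y → x * y ≡ 1#)
    isTotalOrder : IsTotalOrder _≡_ _≤_
    +-mono-≤ : ∀ {x y} z → x ≤ y → x + z ≤ y + z
    *-nonneg : ∀ {x y} → 0# ≤ x → 0# ≤ y → 0# ≤ x * y

module _ {c ℓ} (F : OrderedField c ℓ) where
  open OrderedField F

  -- (a,b,c,d) ∈ closure of F_> : the four "quadrilateral" inequalities
  -- (nonnegativity is assumed separately in the theorem).
  InClosureF> : Carrier → Carrier → Carrier → Carrier → Set ℓ
  InClosureF> a b c d =
    (a ≤ b + c + d) × (b ≤ a + c + d) × (c ≤ a + b + d) × (d ≤ a + b + c)

  record Weights : Set c where
    field
      w1+ w1- w2+ w2- w3+ w3- : Carrier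

  NonNegWeights : Weights → Set ℓ
  NonNegWeights w = (0# ≤ w1+) × (0# ≤ w1-) × (0# ≤ w2+) × (0# ≤ w2-)
                    × (0# ≤ w3+) × (0# ≤ w3-)
    where open Weights w

  Represents : Weights → Carrier → Carrier → Carrier → Carrier → Set c
  Represents w a b c d =
      (a ≡ w1- + w2+ + w3+) × (b ≡ w1+ + w2- + w3+)
    × (c ≡ w1+ + w2+ + w3-) × (d ≡ w1- + w2- + w3-)
    where open Weights w

-- Write w = (x₁, y₁, x₂, y₂, x₃, y₃) for (w⟨1⟩₊, w⟨1⟩₋, …).  Then
-- (a + c) − (b + d) = 2 (x₂ − y₂) and (a + b) − (c + d) = 2 (x₃ − y₃), and
-- b + c + d − a = 2 (x₁ + y₂ + y₃): this gives the inequalities.  Conversely,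
-- flipping the signs of two of the three pairings permutes (a, b, c, d) by a
-- double transposition, so we may assume a + c ≥ b + d and a + b ≥ c + d.
-- Then y₂ = y₃ = 0, y₁ = d, x₂ = ((a + c) − (b + d))/2,
-- x₃ = ((a + b) − (c + d))/2 and x₁ = (b + c + d − a)/2 is a nonnegative
-- solution.

module Submission where

open import Defs
open import Level using (Level; _⊔_)
open import Data.Product using (_×_; Σ; _,_; proj₁; proj₂)
open import Data.Sum using (inj₁; inj₂)
open import Data.Empty using (⊥-elim)
open import Function.Bundles using (_⇔_; mk⇔)
open import Relation.Nullary using (¬_)
open import Relation.Binary.PropositionalEquality
  using (_≡_; refl; sym; trans; cong; cong₂; subst₂; module ≡-Reasoning)
open import Relation.Binary.Structures using (IsTotalOrder)
open import Algebra.Bundles using (CommutativeRing)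

module OrderedFieldProperties {ℓ₁ ℓ₂ : Level} (F : OrderedField ℓ₁ ℓ₂) where
  open OrderedField F public

  commutativeRing : CommutativeRing ℓ₁ ℓ₁
  commutativeRing = record { isCommutativeRing = isCommutativeRing }

  open CommutativeRing commutativeRing
    using (_-_; +-comm; +-assoc; +-identityˡ; -‿inverseʳ; *-comm; *-assoc;
           *-identityˡ; distribˡ; distribʳ; +-abelianGroup; ring)
  open import Algebra.Properties.AbelianGroup +-abelianGroup using (xyx⁻¹≈y)
  open import Algebra.Properties.AbelianGroup +-abelianGroup public
    using () renaming (∙-cancelʳ to +-cancelʳ)
  open import Algebra.Properties.Ring ring using (-1*x≈-x; -‿involutive; -‿distribˡ-*)
  open IsTotalOrder isTotalOrder using (antisym; ≤-respˡ-≈) renaming (trans to ≤-trans)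
  open IsTotalOrder isTotalOrder public using (total; ≤-respʳ-≈) renaming (refl to ≤-refl)

  x+[y-x]≡y : ∀ x y → x + (y - x) ≡ y
  x+[y-x]≡y x y = trans (sym (+-assoc x y (- x))) (xyx⁻¹≈y x y)

  0≤x⇒y≤y+x : ∀ {x} y → 0# ≤ x → y ≤ y + x
  0≤x⇒y≤y+x {x} y 0≤x =
    subst₂ _≤_ (+-identityˡ y) (+-comm x y) (+-mono-≤ y 0≤x)

  x≤y⇒0≤y-x : ∀ {x y} → x ≤ y → 0# ≤ y - x
  x≤y⇒0≤y-x {x} p = ≤-respˡ-≈ (-‿inverseʳ x) (+-mono-≤ (- x) p)

  swap-summands : ∀ {x y u v} → x + y ≤ u + v → y + x ≤ v + u
  swap-summands {x} {y} {u} {v} = subst₂ _≤_ (+-comm x y) (+-comm u v)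

  +-nonneg : ∀ {x y} → 0# ≤ x → 0# ≤ y → 0# ≤ x + y
  +-nonneg {x} 0≤x 0≤y = ≤-trans 0≤x (0≤x⇒y≤y+x x 0≤y)

  x≤0⇒0≤-x : ∀ {x} → x ≤ 0# → 0# ≤ - x
  x≤0⇒0≤-x {x} p = ≤-respʳ-≈ (+-identityˡ (- x)) (x≤y⇒0≤y-x p)

  0≤1 : 0# ≤ 1#
  0≤1 with total 0# 1#
  ... | inj₁ 0≤1 = 0≤1
  ... | inj₂ 1≤0 =
    ≤-respʳ-≈ (trans (-1*x≈-x (- 1#)) (-‿involutive 1#)) (*-nonneg 0≤-1 0≤-1)
    where
    0≤-1 : 0# ≤ - 1#
    0≤-1 = x≤0⇒0≤-x 1≤0

  1≰0 : ¬ (1# ≤ 0#)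
  1≰0 1≤0 = 0≢1 (antisym 0≤1 1≤0)

  ¬0≤-1 : ¬ (0# ≤ - 1#)
  ¬0≤-1 0≤-1 = 1≰0 (≤-respʳ-≈ (-‿inverseʳ 1#) (0≤x⇒y≤y+x 1# 0≤-1))

  1+1≢0 : ¬ (1# + 1# ≡ 0#)
  1+1≢0 1+1≡0 = 1≰0 (≤-respʳ-≈ 1+1≡0 (0≤x⇒y≤y+x 1# 0≤1))

  ½ : Carrier
  ½ = proj₁ (inverse (1# + 1#) 1+1≢0)

  [1+1]*½≡1 : (1# + 1#) * ½ ≡ 1#
  [1+1]*½≡1 = proj₂ (inverse (1# + 1#) 1+1≢0)

  0≤½ : 0# ≤ ½
  0≤½ with total 0# ½
  ... | inj₁ 0≤½ = 0≤½
  ... | inj₂ ½≤0 = ⊥-elim (¬0≤-1 (≤-respʳ-≈ -½*2≡-1 0≤-½*2))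
    where
    open ≡-Reasoning
    0≤-½*2 : 0# ≤ - ½ * (1# + 1#)
    0≤-½*2 = *-nonneg (x≤0⇒0≤-x ½≤0) (+-nonneg 0≤1 0≤1)
    -½*2≡-1 : - ½ * (1# + 1#) ≡ - 1#
    -½*2≡-1 = begin
      - ½ * (1# + 1#)   ≡⟨ sym (-‿distribˡ-* ½ (1# + 1#)) ⟩
      - (½ * (1# + 1#)) ≡⟨ cong -_ (*-comm ½ (1# + 1#)) ⟩
      - ((1# + 1#) * ½) ≡⟨ cong -_ [1+1]*½≡1 ⟩
      - 1#              ∎

  ½*[x+x]≡x : ∀ x → ½ * (x + x) ≡ x
  ½*[x+x]≡x x = begin
    ½ * (x + x)             ≡⟨ cong (λ y → ½ * (y + y)) (sym (*-identityˡ x)) ⟩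
    ½ * (1# * x + 1# * x)   ≡⟨ cong (½ *_) (sym (distribʳ x 1# 1#)) ⟩
    ½ * ((1# + 1#) * x)     ≡⟨ sym (*-assoc ½ (1# + 1#) x) ⟩
    ½ * (1# + 1#) * x       ≡⟨ cong (_* x) (*-comm ½ (1# + 1#)) ⟩
    (1# + 1#) * ½ * x       ≡⟨ cong (_* x) [1+1]*½≡1 ⟩
    1# * x                  ≡⟨ *-identityˡ x ⟩
    x                       ∎
    where open ≡-Reasoning

  halve : ∀ {x} p q r → x + x ≡ p + q + r → x ≡ ½ * p + ½ * q + ½ * r
  halve {x} p q r 2x≡p+q+r = begin
    x                         ≡⟨ sym (½*[x+x]≡x x) ⟩
    ½ * (x + x)               ≡⟨ cong (½ *_) 2x≡p+q+r ⟩
    ½ * (p + q + r)           ≡⟨ distribˡ ½ (p + q) r ⟩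
    ½ * (p + q) + ½ * r       ≡⟨ cong (_+ ½ * r) (distribˡ ½ p q) ⟩
    ½ * p + ½ * q + ½ * r     ∎
    where open ≡-Reasoning

module Representation {ℓ₁ ℓ₂ : Level} (F : OrderedField ℓ₁ ℓ₂) where
  open OrderedFieldProperties F
  open CommutativeRing commutativeRing
    using (_-_; +-identityʳ; +-commutativeSemigroup; commutativeSemiring)
  open import Algebra.Properties.CommutativeSemigroup +-commutativeSemigroup
    using (xy∙z≈xz∙y; xy∙z≈yz∙x; xy∙z≈zx∙y; xy∙z≈zy∙x)
  open import Algebra.Solver.Ring.NaturalCoefficients.Default commutativeSemiring
    using (solve; _:+_; _:=_; con)

  Representable : Carrier → Carrier → Carrier → Carrier → Set (ℓ₁ ⊔ ℓ₂)
  Representable a b c d = Σ (Weights F) (λ w → NonNegWeights F w × Represents F w a b c d)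

  private
    variable
      a b c d : Carrier

  flip₁₂ flip₁₃ flip₂₃ : Weights F → Weights F
  flip₁₂ w = record { w1+ = w1- ; w1- = w1+ ; w2+ = w2- ; w2- = w2+ ; w3+ = w3+ ; w3- = w3- }
    where open Weights w
  flip₁₃ w = record { w1+ = w1- ; w1- = w1+ ; w2+ = w2+ ; w2- = w2- ; w3+ = w3- ; w3- = w3+ }
    where open Weights w
  flip₂₃ w = record { w1+ = w1+ ; w1- = w1- ; w2+ = w2- ; w2- = w2+ ; w3+ = w3- ; w3- = w3+ }
    where open Weights w

  representable-flip₁₂ : Representable a b c d → Representable b a d c
  representable-flip₁₂ (w , (n₁ , m₁ , n₂ , m₂ , n₃ , m₃) , (eᵃ , eᵇ , eᶜ , eᵈ)) =
    flip₁₂ w , (m₁ , n₁ , m₂ , n₂ , n₃ , m₃) , (eᵇ , eᵃ , eᵈ , eᶜ)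

  representable-flip₁₃ : Representable a b c d → Representable c d a b
  representable-flip₁₃ (w , (n₁ , m₁ , n₂ , m₂ , n₃ , m₃) , (eᵃ , eᵇ , eᶜ , eᵈ)) =
    flip₁₃ w , (m₁ , n₁ , n₂ , m₂ , m₃ , n₃) , (eᶜ , eᵈ , eᵃ , eᵇ)

  representable-flip₂₃ : Representable a b c d → Representable d c b a
  representable-flip₂₃ (w , (n₁ , m₁ , n₂ , m₂ , n₃ , m₃) , (eᵃ , eᵇ , eᶜ , eᵈ)) =
    flip₂₃ w , (n₁ , m₁ , m₂ , n₂ , m₃ , n₃) , (eᵈ , eᶜ , eᵇ , eᵃ)

  representable⇒≤sum : Representable a b c d → a ≤ b + c + d
  representable⇒≤sum (w , (0≤x₁ , _ , _ , 0≤y₂ , _ , 0≤y₃) , (refl , refl , refl , refl)) =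
    ≤-respʳ-≈ (sym sum≡) (0≤x⇒y≤y+x _ 0≤slack)
    where
    open Weights w renaming (w1+ to x₁; w1- to y₁; w2+ to x₂; w2- to y₂; w3+ to x₃; w3- to y₃)
    0≤slack : 0# ≤ (x₁ + x₁) + (y₂ + y₂) + (y₃ + y₃)
    0≤slack = +-nonneg (+-nonneg (+-nonneg 0≤x₁ 0≤x₁) (+-nonneg 0≤y₂ 0≤y₂)) (+-nonneg 0≤y₃ 0≤y₃)
    sum≡ : (x₁ + y₂ + x₃) + (x₁ + x₂ + y₃) + (y₁ + y₂ + y₃)
         ≡ (y₁ + x₂ + x₃) + ((x₁ + x₁) + (y₂ + y₂) + (y₃ + y₃))
    sum≡ = solve 6 (λ x₁ y₁ x₂ y₂ x₃ y₃ →
             (x₁ :+ y₂ :+ x₃) :+ (x₁ :+ x₂ :+ y₃) :+ (y₁ :+ y₂ :+ y₃)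
             := (y₁ :+ x₂ :+ x₃) :+ ((x₁ :+ x₁) :+ (y₂ :+ y₂) :+ (y₃ :+ y₃)))
           refl x₁ y₁ x₂ y₂ x₃ y₃

  representable⇒closure : Representable a b c d → InClosureF> F a b c d
  representable⇒closure {a} {b} {c} {d} r =
      representable⇒≤sum r
    , ≤-respʳ-≈ (xy∙z≈xz∙y a d c) (representable⇒≤sum (representable-flip₁₂ r))
    , ≤-respʳ-≈ (xy∙z≈yz∙x d a b) (representable⇒≤sum (representable-flip₁₃ r))
    , ≤-respʳ-≈ (xy∙z≈zy∙x c b a) (representable⇒≤sum (representable-flip₂₃ r))

  halve-representable : (W : Weights F) → NonNegWeights F W →
    Represents F W (a + a) (b + b) (c + c) (d + d) → Representable a b c d
  halve-representable W (n₁ , m₁ , n₂ , m₂ , n₃ , m₃) (eᵃ , eᵇ , eᶜ , eᵈ) =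
      record { w1+ = ½ * w1+ ; w1- = ½ * w1- ; w2+ = ½ * w2+ ; w2- = ½ * w2-
             ; w3+ = ½ * w3+ ; w3- = ½ * w3- }
    , ( *-nonneg 0≤½ n₁ , *-nonneg 0≤½ m₁ , *-nonneg 0≤½ n₂ , *-nonneg 0≤½ m₂
      , *-nonneg 0≤½ n₃ , *-nonneg 0≤½ m₃ )
    , (halve _ _ _ eᵃ , halve _ _ _ eᵇ , halve _ _ _ eᶜ , halve _ _ _ eᵈ)
    where open Weights W

  slackWeights : Carrier → Carrier → Carrier → Carrier → Weights F
  slackWeights d e₁ e₂ e₃ =
    record { w1+ = e₁ ; w1- = d + d ; w2+ = e₂ ; w2- = 0# ; w3+ = e₃ ; w3- = 0# }

  slackWeights-represents-double : ∀ {a b c d e₁ e₂ e₃} →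
    b + c + d ≡ a + e₁ → a + c ≡ b + d + e₂ → a + b ≡ c + d + e₃ →
    Represents F (slackWeights d e₁ e₂ e₃) (a + a) (b + b) (c + c) (d + d)
  slackWeights-represents-double {a} {b} {c} {d} {e₁} {e₂} {e₃} h₁ h₂ h₃ =
    2a≡ , 2b≡ , 2c≡ , 2d≡
    where
    open ≡-Reasoning
    2a≡ : a + a ≡ d + d + e₂ + e₃
    2a≡ = +-cancelʳ (b + c) _ _ (begin
      a + a + (b + c)             ≡⟨ solve 3 (λ a b c → a :+ a :+ (b :+ c)
                                                      := (a :+ c) :+ (a :+ b)) refl a b c ⟩
      (a + c) + (a + b)           ≡⟨ cong₂ _+_ h₂ h₃ ⟩
      (b + d + e₂) + (c + d + e₃) ≡⟨ solve 5 (λ b c d e₂ e₃ → (b :+ d :+ e₂) :+ (c :+ d :+ e₃)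
                                                      := d :+ d :+ e₂ :+ e₃ :+ (b :+ c)) refl b c d e₂ e₃ ⟩
      d + d + e₂ + e₃ + (b + c)   ∎)

    2b≡ : b + b ≡ e₁ + 0# + e₃
    2b≡ = +-cancelʳ (a + c + d) _ _ (begin
      b + b + (a + c + d)         ≡⟨ solve 4 (λ a b c d → b :+ b :+ (a :+ c :+ d)
                                                      := (b :+ c :+ d) :+ (a :+ b)) refl a b c d ⟩
      (b + c + d) + (a + b)       ≡⟨ cong₂ _+_ h₁ h₃ ⟩
      (a + e₁) + (c + d + e₃)     ≡⟨ solve 5 (λ a c d e₁ e₃ → (a :+ e₁) :+ (c :+ d :+ e₃)
                                                      := e₁ :+ con 0 :+ e₃ :+ (a :+ c :+ d)) refl a c d e₁ e₃ ⟩
      e₁ + 0# + e₃ + (a + c + d)  ∎)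

    2c≡ : c + c ≡ e₁ + e₂ + 0#
    2c≡ = +-cancelʳ (a + b + d) _ _ (begin
      c + c + (a + b + d)         ≡⟨ solve 4 (λ a b c d → c :+ c :+ (a :+ b :+ d)
                                                      := (b :+ c :+ d) :+ (a :+ c)) refl a b c d ⟩
      (b + c + d) + (a + c)       ≡⟨ cong₂ _+_ h₁ h₂ ⟩
      (a + e₁) + (b + d + e₂)     ≡⟨ solve 5 (λ a b d e₁ e₂ → (a :+ e₁) :+ (b :+ d :+ e₂)
                                                      := e₁ :+ e₂ :+ con 0 :+ (a :+ b :+ d)) refl a b d e₁ e₂ ⟩
      e₁ + e₂ + 0# + (a + b + d)  ∎)

    2d≡ : d + d ≡ d + d + 0# + 0#
    2d≡ = sym (trans (+-identityʳ (d + d + 0#)) (+-identityʳ (d + d)))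

  b+d≤a+c⇒c+d≤a+b⇒representable : ∀ {a b c d} → 0# ≤ d → a ≤ b + c + d →
    b + d ≤ a + c → c + d ≤ a + b → Representable a b c d
  b+d≤a+c⇒c+d≤a+b⇒representable {a} {b} {c} {d} 0≤d a≤b+c+d b+d≤a+c c+d≤a+b =
    halve-representable (slackWeights d (b + c + d - a) (a + c - (b + d)) (a + b - (c + d)))
      (x≤y⇒0≤y-x a≤b+c+d , +-nonneg 0≤d 0≤d , x≤y⇒0≤y-x b+d≤a+c , ≤-refl ,
       x≤y⇒0≤y-x c+d≤a+b , ≤-refl)
      (slackWeights-represents-double
        (sym (x+[y-x]≡y a (b + c + d)))
        (sym (x+[y-x]≡y (b + d) (a + c)))
        (sym (x+[y-x]≡y (c + d) (a + b))))

  closure⇒representable : 0# ≤ a → 0# ≤ b → 0# ≤ c → 0# ≤ d →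
    InClosureF> F a b c d → Representable a b c d
  closure⇒representable {a} {b} {c} {d} 0≤a 0≤b 0≤c 0≤d (a≤ , b≤ , c≤ , d≤)
    with total (b + d) (a + c) | total (c + d) (a + b)
  ... | inj₁ b+d≤a+c | inj₁ c+d≤a+b =
    b+d≤a+c⇒c+d≤a+b⇒representable 0≤d a≤ b+d≤a+c c+d≤a+b
  ... | inj₂ a+c≤b+d | inj₁ c+d≤a+b = representable-flip₁₂
    (b+d≤a+c⇒c+d≤a+b⇒representable 0≤c (≤-respʳ-≈ (xy∙z≈xz∙y a c d) b≤)
      a+c≤b+d (swap-summands c+d≤a+b))
  ... | inj₁ b+d≤a+c | inj₂ a+b≤c+d = representable-flip₁₃
    (b+d≤a+c⇒c+d≤a+b⇒representable 0≤b (≤-respʳ-≈ (xy∙z≈zx∙y a b d) c≤)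
      (swap-summands b+d≤a+c) a+b≤c+d)
  ... | inj₂ a+c≤b+d | inj₂ a+b≤c+d = representable-flip₂₃
    (b+d≤a+c⇒c+d≤a+b⇒representable 0≤a (≤-respʳ-≈ (xy∙z≈zy∙x a b c) d≤)
      (swap-summands a+c≤b+d) (swap-summands a+b≤c+d))

mainTheorem7 : ∀ {ℓ₁ ℓ₂ : Level} (F : OrderedField ℓ₁ ℓ₂) →
    let open OrderedField F in
    (a b c d : Carrier) →
    0# ≤ a → 0# ≤ b → 0# ≤ c → 0# ≤ d →
    InClosureF> F a b c d ⇔
      Σ (Weights F) (λ w → NonNegWeights F w × Represents F w a b c d)
mainTheorem7 F a b c d 0≤a 0≤b 0≤c 0≤d =
  mk⇔ (closure⇒representable 0≤a 0≤b 0≤c 0≤d) representable⇒closure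
  where open Representation F
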